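{- Let $L=L'\times L''$ be a product of finite geometric lattices. Under the canonical identification $\mathbb{R}[L]\cong\mathbb{R}[L']\otimes\mathbb{R}[L'']$, $e_{(x',x'')}\leftrightarrow e_{x'}\otimes e_{x''}$, the lattice Hamiltonians satisfy $H_L=H_{L'}\otimes I+I\otimes H_{L''}$.
   Context: For a finite geometric lattice $L$ with bottom $\hat0$, $\mathbb{R}[L]$ is the real vector space with orthonormal basis $\{e_x:x\in L\}$, basis vectors identified with lattice elements. The diamond product is given on basis elements by $x\diamond y=x\vee y$ if $x\wedge y=\hat0$ and $0$ otherwise. For an atom $a$, $L_a(x)=a\diamond x$, $L_a^t$ is its transpose, and the lattice Hamiltonian is $H_L=\sum_{a\in\mathcal{A}(L)}(L_a+L_a^t)/2$, where $\mathcal{A}(L)$ is the set of atoms. The product lattice $L'\times L''$ is ordered componentwise. -}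

module Defs where

open import Level using (0ℓ)
open import Data.Product using (_×_; _,_; proj₁; proj₂; ∃)
open import Data.Product.Properties using (≡-dec)
open import Data.Sum using (_⊎_; inj₁; inj₂)
open import Data.List using (List; []; _∷_; foldr; filter; cartesianProduct)
open import Data.List.Membership.Propositional using (_∈_)
open import Data.List.Membership.Propositional.Properties using (∈-cartesianProduct⁺)
open import Data.List.Relation.Unary.Unique.Propositional using (Unique)
open import Data.List.Relation.Unary.Unique.Propositional.Properties using (cartesianProduct⁺)
open import Data.List.Relation.Unary.All as All using (All)
open import Data.Rational using (ℚ; 0ℚ; 1ℚ; ½; _+_; _*_)
open import Relation.Nullary using (Dec; yes; no; ¬_)
open import Relation.Nullary.Decidable using (_×-dec_; _⊎-dec_; _→-dec_; ¬?)
open import Relation.Binary using (Rel; Decidable; DecidableEquality; Minimum; IsPartialOrder)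
open import Relation.Binary.Lattice using (IsLattice)
open import Relation.Binary.PropositionalEquality
  using (_≡_; _≢_; refl; cong₂; isEquivalence; resp₂)

record FiniteLattice : Set₁ where
  infix 4 _≤_
  infixr 6 _∨_
  infixr 7 _∧_
  field
    Carrier   : Set
    _≤_       : Rel Carrier 0ℓ
    _∨_       : Carrier → Carrier → Carrier
    _∧_       : Carrier → Carrier → Carrier
    isLattice : IsLattice _≡_ _≤_ _∨_ _∧_
    ⊥         : Carrier
    ⊥-minimum : Minimum _≤_ ⊥
    elements  : List Carrier
    complete  : ∀ x → x ∈ elements
    unique    : Unique elements
    -- decidability of equality and order (automatic for finite lattices
    -- classically; needed constructively to count)
    _≟_       : DecidableEquality Carrier
    _≤?_      : Decidable _≤_

  _⋖_ : Carrier → Carrier → Set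
  x ⋖ y = (x ≤ y) × (x ≢ y) × (∀ z → x ≤ z → z ≤ y → (z ≡ x) ⊎ (z ≡ y))

  IsAtom : Carrier → Set
  IsAtom a = ⊥ ⋖ a

Elem : FiniteLattice → Set
Elem = FiniteLattice.Carrier

record IsGeometric (L : FiniteLattice) : Set where
  open FiniteLattice L
  field
    atomistic    : ∀ x → ∃ λ (as : List Carrier) →
                     All IsAtom as × foldr _∨_ ⊥ as ≡ x
    semimodular  : ∀ x y → (x ∧ y) ⋖ x → y ⋖ (x ∨ y)

module _ (L : FiniteLattice) where
  open FiniteLattice L

  private
    P : Carrier → Carrier → Carrier → Set
    P x y z = x ≤ z → z ≤ y → (z ≡ x) ⊎ (z ≡ y)

    P? : ∀ x y z → Dec (P x y z)
    P? x y z = (x ≤? z) →-dec ((z ≤? y) →-dec ((z ≟ x) ⊎-dec (z ≟ y)))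

  ⋖? : ∀ x y → Dec (x ⋖ y)
  ⋖? x y with All.all? (P? x y) elements
  ... | yes all = (x ≤? y) ×-dec (¬? (x ≟ y)) ×-dec yes (λ z → All.lookup all (complete z))
  ... | no ¬all = (x ≤? y) ×-dec (¬? (x ≟ y)) ×-dec no (λ h → ¬all (All.tabulate (λ {z} _ → h z)))

  isAtom? : ∀ a → Dec (IsAtom a)
  isAtom? a = ⋖? ⊥ a

  atoms : List Carrier
  atoms = filter isAtom? elements

-- Operators on ℝ[L] as matrices indexed by L (entries are rational).
-- M y x is the coefficient of e_y in M(e_x).

Matrix : FiniteLattice → Set
Matrix L = Elem L → Elem L → ℚ

sumℚ : {A : Set} → List A → (A → ℚ) → ℚ
sumℚ xs f = foldr (λ a r → f a + r) 0ℚ xs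

⟦_⟧ : {A : Set} → Dec A → ℚ
⟦ yes _ ⟧ = 1ℚ
⟦ no _ ⟧  = 0ℚ

module _ (L : FiniteLattice) where
  open FiniteLattice L

  -- diamond product on basis vectors: a ⋄ x = a ∨ x if a ∧ x = ⊥, else 0.
  -- Matrix of L_a : e_x ↦ a ⋄ x.
  Lmat : Carrier → Matrix L
  Lmat a y x = ⟦ ((a ∧ x) ≟ ⊥) ×-dec ((a ∨ x) ≟ y) ⟧

  Lmatᵗ : Carrier → Matrix L
  Lmatᵗ a y x = Lmat a x y

  hamiltonian : Matrix L
  hamiltonian y x = sumℚ (atoms L) (λ a → ½ * (Lmat a y x + Lmatᵗ a y x))

  idMat : Matrix L
  idMat y x = ⟦ y ≟ x ⟧

-- Kronecker (tensor) product of matrices, read through the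
-- identification e_(x',x'') ↔ e_x' ⊗ e_x''.
_⊗_ : {L₁ L₂ : FiniteLattice} → Matrix L₁ → Matrix L₂ →
      Elem L₁ × Elem L₂ → Elem L₁ × Elem L₂ → ℚ
(A ⊗ B) (y₁ , y₂) (x₁ , x₂) = A y₁ x₁ * B y₂ x₂

module _ (L₁ L₂ : FiniteLattice) where
  private
    module A = FiniteLattice L₁
    module B = FiniteLattice L₂
    module AL = IsLattice A.isLattice
    module BL = IsLattice B.isLattice

    C = A.Carrier × B.Carrier

    _≤ₚ_ : Rel C 0ℓ
    (x₁ , x₂) ≤ₚ (y₁ , y₂) = (x₁ A.≤ y₁) × (x₂ B.≤ y₂)

    po : IsPartialOrder _≡_ _≤ₚ_
    po = record
      { isPreorder = record
        { isEquivalence = isEquivalence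
        ; reflexive = λ { refl → AL.refl , BL.refl }
        ; trans = λ (p , q) (r , s) → AL.trans p r , BL.trans q s
        }
      ; antisym = λ (p , q) (r , s) → cong₂ _,_ (AL.antisym p r) (BL.antisym q s)
      }

  productLattice : FiniteLattice
  productLattice = record
    { Carrier   = C
    ; _≤_       = _≤ₚ_
    ; _∨_       = λ (x₁ , x₂) (y₁ , y₂) → (x₁ A.∨ y₁) , (x₂ B.∨ y₂)
    ; _∧_       = λ (x₁ , x₂) (y₁ , y₂) → (x₁ A.∧ y₁) , (x₂ B.∧ y₂)
    ; isLattice = record
      { isPartialOrder = po
      ; supremum = λ (x₁ , x₂) (y₁ , y₂) →
          (AL.x≤x∨y x₁ y₁ , BL.x≤x∨y x₂ y₂) ,
          (AL.y≤x∨y x₁ y₁ , BL.y≤x∨y x₂ y₂) ,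
          λ z (p , q) (r , s) → AL.∨-least p r , BL.∨-least q s
      ; infimum = λ (x₁ , x₂) (y₁ , y₂) →
          (AL.x∧y≤x x₁ y₁ , BL.x∧y≤x x₂ y₂) ,
          (AL.x∧y≤y x₁ y₁ , BL.x∧y≤y x₂ y₂) ,
          λ z (p , q) (r , s) → AL.∧-greatest p r , BL.∧-greatest q s
      }
    ; ⊥         = A.⊥ , B.⊥
    ; ⊥-minimum = λ (x₁ , x₂) → A.⊥-minimum x₁ , B.⊥-minimum x₂
    ; elements  = cartesianProduct A.elements B.elements
    ; complete  = λ (x₁ , x₂) → ∈-cartesianProduct⁺ (A.complete x₁) (B.complete x₂)
    ; unique    = cartesianProduct⁺ A.unique B.unique
    ; _≟_       = ≡-dec A._≟_ B._≟_
    ; _≤?_      = λ (x₁ , x₂) (y₁ , y₂) → (x₁ A.≤? y₁) ×-dec (x₂ B.≤? y₂)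
    }

{-# OPTIONS --safe #-}
module Submission where

-- An atom of L′ × L″ is either (a , ⊥) or (⊥ , b) with a, b atoms of the
-- factors, so the sum defining H_L splits into a sum over 𝒜(L′) and one over
-- 𝒜(L″).  Since (a , ⊥) ⋄ (x′ , x″) = (a ⋄ x′ , x″), the operator L_(a,⊥) is
-- L_a ⊗ I, and likewise L_(⊥,b) = I ⊗ L_b; as I is symmetric, symmetrising
-- and summing gives H_L′ ⊗ I + I ⊗ H_L″.

open import Defs
open import Algebra.Bundles using (CommutativeMonoid)
open import Data.Empty using (⊥-elim)
open import Data.List using (List; []; _∷_; _++_; map; filter; cartesianProduct)
open import Data.List.Membership.Propositional using (_∈_)
open import Data.List.Properties using (foldr-map)
open import Data.List.Relation.Unary.All as All using (All; []; _∷_)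
open import Data.List.Relation.Unary.AllPairs using ([]; _∷_)
open import Data.List.Relation.Unary.Any using (here; there)
open import Data.List.Relation.Unary.Unique.Propositional using (Unique)
open import Data.Product using (_×_; _,_; proj₁; proj₂)
open import Data.Rational using (ℚ; 0ℚ; ½; _+_; _*_)
open import Data.Rational.Properties
  using (+-identityˡ; +-identityʳ; +-assoc; *-zeroˡ; *-zeroʳ;
         *-distribˡ-+; *-distribʳ-+; +-0-commutativeMonoid)
open import Data.Rational.Solver using (module +-*-Solver)
import Data.Sum as Sum
open import Data.Sum using (_⊎_; inj₁; inj₂)
open import Function.Bundles using (_⇔_; mk⇔; Equivalence)
open import Level using (0ℓ)
open import Relation.Binary using (DecidableEquality)
open import Relation.Binary.Lattice using (IsLattice)
open import Relation.Binary.PropositionalEquality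
  using (_≡_; refl; sym; trans; cong; cong₂; module ≡-Reasoning)
open import Relation.Nullary using (Dec; yes; no; ¬_)
open import Relation.Nullary.Decidable using (_×-dec_)
open import Relation.Unary using (Pred) renaming (Decidable to Decidable₁)

open import Algebra.Properties.CommutativeSemigroup
  (CommutativeMonoid.commutativeSemigroup +-0-commutativeMonoid) using (interchange)

private
  variable
    A B X Y : Set

sumℚ-cong : (xs : List A) {f g : A → ℚ} → (∀ z → f z ≡ g z) → sumℚ xs f ≡ sumℚ xs g
sumℚ-cong []       f≗g = refl
sumℚ-cong (x ∷ xs) f≗g = cong₂ _+_ (f≗g x) (sumℚ-cong xs f≗g)

sumℚ-zero : (xs : List A) → sumℚ xs (λ _ → 0ℚ) ≡ 0ℚ
sumℚ-zero []       = refl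
sumℚ-zero (x ∷ xs) = trans (+-identityˡ _) (sumℚ-zero xs)

sumℚ-+ : (xs : List A) (f g : A → ℚ) →
         sumℚ xs (λ z → f z + g z) ≡ sumℚ xs f + sumℚ xs g
sumℚ-+ []       f g = sym (+-identityˡ 0ℚ)
sumℚ-+ (x ∷ xs) f g =
  trans (cong (f x + g x +_) (sumℚ-+ xs f g)) (interchange (f x) (g x) _ _)

sumℚ-*ˡ : (c : ℚ) (xs : List A) (f : A → ℚ) →
          sumℚ xs (λ z → c * f z) ≡ c * sumℚ xs f
sumℚ-*ˡ c []       f = sym (*-zeroʳ c)
sumℚ-*ˡ c (x ∷ xs) f =
  trans (cong (c * f x +_) (sumℚ-*ˡ c xs f)) (sym (*-distribˡ-+ c (f x) _))

sumℚ-*ʳ : (c : ℚ) (xs : List A) (f : A → ℚ) →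
          sumℚ xs (λ z → f z * c) ≡ sumℚ xs f * c
sumℚ-*ʳ c []       f = sym (*-zeroˡ c)
sumℚ-*ʳ c (x ∷ xs) f =
  trans (cong (f x * c +_) (sumℚ-*ʳ c xs f)) (sym (*-distribʳ-+ c (f x) _))

sumℚ-++ : (xs ys : List A) (f : A → ℚ) → sumℚ (xs ++ ys) f ≡ sumℚ xs f + sumℚ ys f
sumℚ-++ []       ys f = sym (+-identityˡ _)
sumℚ-++ (x ∷ xs) ys f = trans (cong (f x +_) (sumℚ-++ xs ys f)) (sym (+-assoc (f x) _ _))

sumℚ-cartesianProduct : (xs : List A) (ys : List B) (f : A × B → ℚ) →
  sumℚ (cartesianProduct xs ys) f ≡ sumℚ xs (λ a → sumℚ ys (λ b → f (a , b)))
sumℚ-cartesianProduct []       ys f = refl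
sumℚ-cartesianProduct (x ∷ xs) ys f =
  trans (sumℚ-++ (map (x ,_) ys) _ f)
        (cong₂ _+_ (foldr-map _ (x ,_) 0ℚ ys) (sumℚ-cartesianProduct xs ys f))

when : Dec X → ℚ → ℚ
when (yes _) q = q
when (no _)  _ = 0ℚ

when-yes : (d : Dec X) {q : ℚ} → X → when d q ≡ q
when-yes (yes _) _ = refl
when-yes (no ¬x) x = ⊥-elim (¬x x)

when-no : (d : Dec X) {q : ℚ} → ¬ X → when d q ≡ 0ℚ
when-no (yes x) ¬x = ⊥-elim (¬x x)
when-no (no _)  _  = refl

when-when : (d : Dec X) (e : Dec Y) (q : ℚ) → when d (when e q) ≡ when (d ×-dec e) q
when-when (yes _) (yes _) q = refl
when-when (yes _) (no _)  q = refl
when-when (no _)  _       q = refl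

sumℚ-filter : {P : Pred A 0ℓ} (P? : Decidable₁ P) (xs : List A) (f : A → ℚ) →
              sumℚ (filter P? xs) f ≡ sumℚ xs (λ z → when (P? z) (f z))
sumℚ-filter P? []       f = refl
sumℚ-filter P? (x ∷ xs) f with P? x
... | yes _ = cong (f x +_) (sumℚ-filter P? xs f)
... | no _  = trans (sumℚ-filter P? xs f) (sym (+-identityˡ _))

sumℚ-when : (d : Dec X) (xs : List A) (f : A → ℚ) →
            sumℚ xs (λ z → when d (f z)) ≡ when d (sumℚ xs f)
sumℚ-when (yes _) xs f = refl
sumℚ-when (no _)  xs f = sumℚ-zero xs

module _ (_≟_ : DecidableEquality A) where

  sumℚ-≟-∉ : (xs : List A) (x : A) (f : A → ℚ) → All (λ z → ¬ z ≡ x) xs →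
             sumℚ xs (λ z → when (z ≟ x) (f z)) ≡ 0ℚ
  sumℚ-≟-∉ []       x f []          = refl
  sumℚ-≟-∉ (z ∷ zs) x f (z≢x ∷ zs≢x) =
    trans (cong (_+ _) (when-no (z ≟ x) z≢x)) (trans (+-identityˡ _) (sumℚ-≟-∉ zs x f zs≢x))

  sumℚ-≟ : (xs : List A) (x : A) (f : A → ℚ) → Unique xs → x ∈ xs →
           sumℚ xs (λ z → when (z ≟ x) (f z)) ≡ f x
  sumℚ-≟ (z ∷ zs) x f (z∉zs ∷ _) (here refl) =
    trans (cong₂ _+_ (when-yes (z ≟ z) refl)
                     (sumℚ-≟-∉ zs z f (All.map (λ z≢w w≡z → z≢w (sym w≡z)) z∉zs)))
          (+-identityʳ _)
  sumℚ-≟ (z ∷ zs) x f (z∉zs ∷ zs!) (there x∈zs) =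
    trans (cong₂ _+_ (when-no (z ≟ x) λ { refl → All.lookup z∉zs x∈zs refl })
                     (sumℚ-≟ zs x f zs! x∈zs))
          (+-identityˡ _)

sumℚ-axes : (_≟ᴬ_ : DecidableEquality A) (_≟ᴮ_ : DecidableEquality B)
            {xs : List A} {ys : List B} {x₀ : A} {y₀ : B} →
            Unique xs → Unique ys → x₀ ∈ xs → y₀ ∈ ys →
            (f : A → ℚ) (g : B → ℚ) →
            sumℚ xs (λ a → sumℚ ys (λ b → when (b ≟ᴮ y₀) (f a) + when (a ≟ᴬ x₀) (g b)))
              ≡ sumℚ xs f + sumℚ ys g
sumℚ-axes _≟ᴬ_ _≟ᴮ_ {xs} {ys} {x₀} {y₀} xs! ys! x₀∈xs y₀∈ys f g = begin
  sumℚ xs (λ a → sumℚ ys (λ b → when (b ≟ᴮ y₀) (f a) + when (a ≟ᴬ x₀) (g b)))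
    ≡⟨ sumℚ-cong xs (λ a →
         sumℚ-+ ys (λ b → when (b ≟ᴮ y₀) (f a)) (λ b → when (a ≟ᴬ x₀) (g b))) ⟩
  sumℚ xs (λ a → sumℚ ys (λ b → when (b ≟ᴮ y₀) (f a)) + sumℚ ys (λ b → when (a ≟ᴬ x₀) (g b)))
    ≡⟨ sumℚ-cong xs (λ a → cong₂ _+_ (sumℚ-≟ _≟ᴮ_ ys y₀ (λ _ → f a) ys! y₀∈ys)
                                      (sumℚ-when (a ≟ᴬ x₀) ys g)) ⟩
  sumℚ xs (λ a → f a + when (a ≟ᴬ x₀) (sumℚ ys g))
    ≡⟨ sumℚ-+ xs f _ ⟩
  sumℚ xs f + sumℚ xs (λ a → when (a ≟ᴬ x₀) (sumℚ ys g))
    ≡⟨ cong (sumℚ xs f +_) (sumℚ-≟ _≟ᴬ_ xs x₀ (λ _ → sumℚ ys g) xs! x₀∈xs) ⟩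
  sumℚ xs f + sumℚ ys g
    ∎
  where open ≡-Reasoning

⟦⟧-cong : (d : Dec X) (e : Dec Y) → X ⇔ Y → ⟦ d ⟧ ≡ ⟦ e ⟧
⟦⟧-cong (yes _) (yes _) _   = refl
⟦⟧-cong (yes x) (no ¬y) x⇔y = ⊥-elim (¬y (Equivalence.to x⇔y x))
⟦⟧-cong (no ¬x) (yes y) x⇔y = ⊥-elim (¬x (Equivalence.from x⇔y y))
⟦⟧-cong (no _)  (no _)  _   = refl

⟦⟧-×-dec : (d : Dec X) (e : Dec Y) → ⟦ d ×-dec e ⟧ ≡ ⟦ d ⟧ * ⟦ e ⟧
⟦⟧-×-dec (yes _) (yes _) = refl
⟦⟧-×-dec (yes _) (no _)  = refl
⟦⟧-×-dec (no _)  (yes _) = refl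
⟦⟧-×-dec (no _)  (no _)  = refl

-- (M + Mᵗ)/2, so that hamiltonian L y x unfolds to the sum of symPart (Lmat L a) y x
-- over the atoms a.
symPart : (A → A → ℚ) → A → A → ℚ
symPart M y x = ½ * (M y x + M x y)

symPart-cong : {M N : A → A → ℚ} → (∀ y x → M y x ≡ N y x) →
               ∀ y x → symPart M y x ≡ symPart N y x
symPart-cong M≗N y x = cong (½ *_) (cong₂ _+_ (M≗N y x) (M≗N x y))

symPart-⊗ˡ : {L₁ L₂ : FiniteLattice} (M : Matrix L₁) (S : Matrix L₂) →
             (∀ y x → S y x ≡ S x y) →
             ∀ y x → symPart (_⊗_ {L₁} {L₂} M S) y x ≡ _⊗_ {L₁} {L₂} (symPart M) S y x
symPart-⊗ˡ M S S-sym (y₁ , y₂) (x₁ , x₂) = begin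
  ½ * (M y₁ x₁ * S y₂ x₂ + M x₁ y₁ * S x₂ y₂)
    ≡⟨ cong (λ s → ½ * (M y₁ x₁ * S y₂ x₂ + M x₁ y₁ * s)) (S-sym x₂ y₂) ⟩
  ½ * (M y₁ x₁ * S y₂ x₂ + M x₁ y₁ * S y₂ x₂)
    ≡⟨ solve 4 (λ h m n s → h :* (m :* s :+ n :* s) := (h :* (m :+ n)) :* s)
             refl ½ (M y₁ x₁) (M x₁ y₁) (S y₂ x₂) ⟩
  ½ * (M y₁ x₁ + M x₁ y₁) * S y₂ x₂
    ∎
  where open ≡-Reasoning; open +-*-Solver

symPart-⊗ʳ : {L₁ L₂ : FiniteLattice} (S : Matrix L₁) (M : Matrix L₂) →
             (∀ y x → S y x ≡ S x y) →
             ∀ y x → symPart (_⊗_ {L₁} {L₂} S M) y x ≡ _⊗_ {L₁} {L₂} S (symPart M) y x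
symPart-⊗ʳ S M S-sym (y₁ , y₂) (x₁ , x₂) = begin
  ½ * (S y₁ x₁ * M y₂ x₂ + S x₁ y₁ * M x₂ y₂)
    ≡⟨ cong (λ s → ½ * (S y₁ x₁ * M y₂ x₂ + s * M x₂ y₂)) (S-sym x₁ y₁) ⟩
  ½ * (S y₁ x₁ * M y₂ x₂ + S y₁ x₁ * M x₂ y₂)
    ≡⟨ solve 4 (λ h s m n → h :* (s :* m :+ s :* n) := s :* (h :* (m :+ n)))
             refl ½ (S y₁ x₁) (M y₂ x₂) (M x₂ y₂) ⟩
  S y₁ x₁ * (½ * (M y₂ x₂ + M x₂ y₂))
    ∎
  where open ≡-Reasoning; open +-*-Solver

idMat-sym : ∀ L y x → idMat L y x ≡ idMat L x y
idMat-sym L y x = ⟦⟧-cong (y ≟ x) (x ≟ y) (mk⇔ sym sym)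
  where open FiniteLattice L

module _ (L : FiniteLattice) where
  open FiniteLattice L
  open IsLattice isLattice using (antisym; ∨-least; y≤x∨y; x∧y≤x) renaming (refl to ≤-refl)

  ⊥∨x≡x : ∀ x → ⊥ ∨ x ≡ x
  ⊥∨x≡x x = antisym (∨-least (⊥-minimum x) ≤-refl) (y≤x∨y ⊥ x)

  ⊥∧x≡⊥ : ∀ x → ⊥ ∧ x ≡ ⊥
  ⊥∧x≡⊥ x = antisym (x∧y≤x ⊥ x) (⊥-minimum _)

  atom≢⊥ : ∀ {a} → IsAtom a → ¬ a ≡ ⊥
  atom≢⊥ (_ , ⊥≢a , _) a≡⊥ = ⊥≢a (sym a≡⊥)

module _ (L′ L″ : FiniteLattice) where
  private
    P = productLattice L′ L″
    module A = FiniteLattice L′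
    module B = FiniteLattice L″
    module P = FiniteLattice P
    module A≤ = IsLattice A.isLattice
    module B≤ = IsLattice B.isLattice

  atom×⊥ : ∀ {a} → A.IsAtom a → P.IsAtom (a , B.⊥)
  atom×⊥ (⊥≤a , ⊥≢a , covers) =
    (⊥≤a , B≤.refl) , (λ e → ⊥≢a (cong proj₁ e)) ,
    λ { (z₁ , z₂) (⊥≤z₁ , ⊥≤z₂) (z₁≤a , z₂≤⊥) →
          let z₂≡⊥ = B≤.antisym z₂≤⊥ ⊥≤z₂
          in Sum.map (λ e → cong₂ _,_ e z₂≡⊥) (λ e → cong₂ _,_ e z₂≡⊥) (covers z₁ ⊥≤z₁ z₁≤a) }

  ⊥×atom : ∀ {b} → B.IsAtom b → P.IsAtom (A.⊥ , b)
  ⊥×atom (⊥≤b , ⊥≢b , covers) =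
    (A≤.refl , ⊥≤b) , (λ e → ⊥≢b (cong proj₂ e)) ,
    λ { (z₁ , z₂) (⊥≤z₁ , ⊥≤z₂) (z₁≤⊥ , z₂≤b) →
          let z₁≡⊥ = A≤.antisym z₁≤⊥ ⊥≤z₁
          in Sum.map (cong₂ _,_ z₁≡⊥) (cong₂ _,_ z₁≡⊥) (covers z₂ ⊥≤z₂ z₂≤b) }

  atom-× : ∀ {a b} → P.IsAtom (a , b) → (a ≡ A.⊥ × B.IsAtom b) ⊎ (b ≡ B.⊥ × A.IsAtom a)
  atom-× {a} {b} ((⊥≤a , ⊥≤b) , ⊥≢ab , covers) with a A.≟ A.⊥
  ... | yes refl = inj₁ (refl , ⊥≤b , (λ e → ⊥≢ab (cong (A.⊥ ,_) e)) ,
          λ z ⊥≤z z≤b → Sum.map (cong proj₂) (cong proj₂)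
                                (covers (A.⊥ , z) (A≤.refl , ⊥≤z) (A≤.refl , z≤b)))
  ... | no a≢⊥ with covers (a , B.⊥) (⊥≤a , B≤.refl) (A≤.refl , ⊥≤b)
  ...   | inj₁ a⊥≡⊥⊥ = ⊥-elim (a≢⊥ (cong proj₁ a⊥≡⊥⊥))
  ...   | inj₂ a⊥≡ab with cong proj₂ a⊥≡ab
  ...     | refl = inj₂ (refl , ⊥≤a , (λ e → ⊥≢ab (cong (_, B.⊥) e)) ,
          λ z ⊥≤z z≤a → Sum.map (cong proj₁) (cong proj₁)
                                (covers (z , B.⊥) (⊥≤z , B≤.refl) (z≤a , B≤.refl)))

  when-isAtom-× : (F : P.Carrier → ℚ) (a : A.Carrier) (b : B.Carrier) →
    when (isAtom? P (a , b)) (F (a , b))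
      ≡ when (b B.≟ B.⊥) (when (isAtom? L′ a) (F (a , B.⊥)))
        + when (a A.≟ A.⊥) (when (isAtom? L″ b) (F (A.⊥ , b)))
  when-isAtom-× F a b with isAtom? P (a , b)
  ... | yes ab-atom with atom-× ab-atom
  ...   | inj₁ (refl , b-atom) = sym (begin
    when (b B.≟ B.⊥) (when (isAtom? L′ A.⊥) _) + when (A.⊥ A.≟ A.⊥) (when (isAtom? L″ b) _)
      ≡⟨ cong₂ _+_ (when-no (b B.≟ B.⊥) (atom≢⊥ L″ b-atom))
                   (trans (when-yes (A.⊥ A.≟ A.⊥) refl) (when-yes (isAtom? L″ b) b-atom)) ⟩
    0ℚ + F (A.⊥ , b)
      ≡⟨ +-identityˡ _ ⟩
    F (A.⊥ , b) ∎)
    where open ≡-Reasoning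
  ...   | inj₂ (refl , a-atom) = sym (begin
    when (B.⊥ B.≟ B.⊥) (when (isAtom? L′ a) _) + when (a A.≟ A.⊥) (when (isAtom? L″ B.⊥) _)
      ≡⟨ cong₂ _+_ (trans (when-yes (B.⊥ B.≟ B.⊥) refl) (when-yes (isAtom? L′ a) a-atom))
                   (when-no (a A.≟ A.⊥) (atom≢⊥ L′ a-atom)) ⟩
    F (a , B.⊥) + 0ℚ
      ≡⟨ +-identityʳ _ ⟩
    F (a , B.⊥) ∎)
    where open ≡-Reasoning
  when-isAtom-× F a b | no ¬ab-atom = sym (trans
    (cong₂ _+_ (trans (when-when (b B.≟ B.⊥) (isAtom? L′ a) _)
                      (when-no (b B.≟ B.⊥ ×-dec isAtom? L′ a)
                               λ { (refl , a-atom) → ¬ab-atom (atom×⊥ a-atom) }))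
               (trans (when-when (a A.≟ A.⊥) (isAtom? L″ b) _)
                      (when-no (a A.≟ A.⊥ ×-dec isAtom? L″ b)
                               λ { (refl , b-atom) → ¬ab-atom (⊥×atom b-atom) })))
    (+-identityˡ 0ℚ))

  sumℚ-atoms-× : (F : P.Carrier → ℚ) →
    sumℚ (atoms P) F ≡ sumℚ (atoms L′) (λ a → F (a , B.⊥)) + sumℚ (atoms L″) (λ b → F (A.⊥ , b))
  sumℚ-atoms-× F = begin
    sumℚ (atoms P) F
      ≡⟨ sumℚ-filter (isAtom? P) P.elements F ⟩
    sumℚ P.elements (λ p → when (isAtom? P p) (F p))
      ≡⟨ sumℚ-cartesianProduct A.elements B.elements (λ p → when (isAtom? P p) (F p)) ⟩
    sumℚ A.elements (λ a → sumℚ B.elements (λ b → when (isAtom? P (a , b)) (F (a , b))))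
      ≡⟨ sumℚ-cong A.elements (λ a → sumℚ-cong B.elements (when-isAtom-× F a)) ⟩
    sumℚ A.elements (λ a → sumℚ B.elements (λ b →
      when (b B.≟ B.⊥) (when (isAtom? L′ a) (F (a , B.⊥)))
      + when (a A.≟ A.⊥) (when (isAtom? L″ b) (F (A.⊥ , b)))))
      ≡⟨ sumℚ-axes A._≟_ B._≟_ A.unique B.unique (A.complete A.⊥) (B.complete B.⊥) _ _ ⟩
    sumℚ A.elements (λ a → when (isAtom? L′ a) (F (a , B.⊥)))
    + sumℚ B.elements (λ b → when (isAtom? L″ b) (F (A.⊥ , b)))
      ≡⟨ sym (cong₂ _+_ (sumℚ-filter (isAtom? L′) A.elements _)
                        (sumℚ-filter (isAtom? L″) B.elements _)) ⟩
    sumℚ (atoms L′) (λ a → F (a , B.⊥)) + sumℚ (atoms L″) (λ b → F (A.⊥ , b))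
      ∎
    where open ≡-Reasoning

  ⋄-⊥ʳ : ∀ a {y₁ y₂ x₁ x₂} →
    ((a , B.⊥) P.∧ (x₁ , x₂) ≡ P.⊥ × (a , B.⊥) P.∨ (x₁ , x₂) ≡ (y₁ , y₂))
      ⇔ ((a A.∧ x₁ ≡ A.⊥ × a A.∨ x₁ ≡ y₁) × y₂ ≡ x₂)
  ⋄-⊥ʳ a {x₂ = x₂} = mk⇔
    (λ (e∧ , e∨) → (cong proj₁ e∧ , cong proj₁ e∨) , trans (sym (cong proj₂ e∨)) (⊥∨x≡x L″ x₂))
    (λ ((e∧ , e∨) , y₂≡x₂) →
      cong₂ _,_ e∧ (⊥∧x≡⊥ L″ x₂) , cong₂ _,_ e∨ (trans (⊥∨x≡x L″ x₂) (sym y₂≡x₂)))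

  Lmat-⊥ʳ : ∀ a y x → Lmat P (a , B.⊥) y x ≡ _⊗_ {L′} {L″} (Lmat L′ a) (idMat L″) y x
  Lmat-⊥ʳ a (y₁ , y₂) (x₁ , x₂) =
    trans (⟦⟧-cong (((a , B.⊥) P.∧ (x₁ , x₂)) P.≟ P.⊥
                      ×-dec ((a , B.⊥) P.∨ (x₁ , x₂)) P.≟ (y₁ , y₂))
                   (a⋄x₁≡y₁? ×-dec y₂ B.≟ x₂)
                   (⋄-⊥ʳ a))
          (⟦⟧-×-dec a⋄x₁≡y₁? (y₂ B.≟ x₂))
    where
      a⋄x₁≡y₁? : Dec (a A.∧ x₁ ≡ A.⊥ × a A.∨ x₁ ≡ y₁)
      a⋄x₁≡y₁? = (a A.∧ x₁) A.≟ A.⊥ ×-dec (a A.∨ x₁) A.≟ y₁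

  ⋄-⊥ˡ : ∀ b {y₁ y₂ x₁ x₂} →
    ((A.⊥ , b) P.∧ (x₁ , x₂) ≡ P.⊥ × (A.⊥ , b) P.∨ (x₁ , x₂) ≡ (y₁ , y₂))
      ⇔ (y₁ ≡ x₁ × (b B.∧ x₂ ≡ B.⊥ × b B.∨ x₂ ≡ y₂))
  ⋄-⊥ˡ b {x₁ = x₁} = mk⇔
    (λ (e∧ , e∨) → trans (sym (cong proj₁ e∨)) (⊥∨x≡x L′ x₁) , (cong proj₂ e∧ , cong proj₂ e∨))
    (λ (y₁≡x₁ , (e∧ , e∨)) →
      cong₂ _,_ (⊥∧x≡⊥ L′ x₁) e∧ , cong₂ _,_ (trans (⊥∨x≡x L′ x₁) (sym y₁≡x₁)) e∨)

  Lmat-⊥ˡ : ∀ b y x → Lmat P (A.⊥ , b) y x ≡ _⊗_ {L′} {L″} (idMat L′) (Lmat L″ b) y x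
  Lmat-⊥ˡ b (y₁ , y₂) (x₁ , x₂) =
    trans (⟦⟧-cong (((A.⊥ , b) P.∧ (x₁ , x₂)) P.≟ P.⊥
                      ×-dec ((A.⊥ , b) P.∨ (x₁ , x₂)) P.≟ (y₁ , y₂))
                   (y₁ A.≟ x₁ ×-dec b⋄x₂≡y₂?)
                   (⋄-⊥ˡ b))
          (⟦⟧-×-dec (y₁ A.≟ x₁) b⋄x₂≡y₂?)
    where
      b⋄x₂≡y₂? : Dec (b B.∧ x₂ ≡ B.⊥ × b B.∨ x₂ ≡ y₂)
      b⋄x₂≡y₂? = (b B.∧ x₂) B.≟ B.⊥ ×-dec (b B.∨ x₂) B.≟ y₂

  sumℚ-atoms-⊥ʳ : ∀ y x → sumℚ (atoms L′) (λ a → symPart (Lmat P (a , B.⊥)) y x)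
                            ≡ _⊗_ {L′} {L″} (hamiltonian L′) (idMat L″) y x
  sumℚ-atoms-⊥ʳ y@(y₁ , y₂) x@(x₁ , x₂) =
    trans (sumℚ-cong (atoms L′) λ a →
             trans (symPart-cong (Lmat-⊥ʳ a) y x)
                   (symPart-⊗ˡ {L′} {L″} (Lmat L′ a) (idMat L″) (idMat-sym L″) y x))
          (sumℚ-*ʳ (idMat L″ y₂ x₂) (atoms L′) (λ a → symPart (Lmat L′ a) y₁ x₁))

  sumℚ-atoms-⊥ˡ : ∀ y x → sumℚ (atoms L″) (λ b → symPart (Lmat P (A.⊥ , b)) y x)
                            ≡ _⊗_ {L′} {L″} (idMat L′) (hamiltonian L″) y x
  sumℚ-atoms-⊥ˡ y@(y₁ , y₂) x@(x₁ , x₂) =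
    trans (sumℚ-cong (atoms L″) λ b →
             trans (symPart-cong (Lmat-⊥ˡ b) y x)
                   (symPart-⊗ʳ {L′} {L″} (idMat L′) (Lmat L″ b) (idMat-sym L′) y x))
          (sumℚ-*ˡ (idMat L′ y₁ x₁) (atoms L″) (λ b → symPart (Lmat L″ b) y₂ x₂))

proposition6p1 : (L′ L″ : FiniteLattice) → IsGeometric L′ → IsGeometric L″ →
    ∀ (y x : Elem L′ × Elem L″) →
    hamiltonian (productLattice L′ L″) y x
      ≡ (_⊗_ {L′} {L″} (hamiltonian L′) (idMat L″)) y x
        + (_⊗_ {L′} {L″} (idMat L′) (hamiltonian L″)) y x
proposition6p1 L′ L″ _ _ y x =
  trans (sumℚ-atoms-× L′ L″ (λ p → symPart (Lmat (productLattice L′ L″) p) y x))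
        (cong₂ _+_ (sumℚ-atoms-⊥ʳ L′ L″ y x) (sumℚ-atoms-⊥ˡ L′ L″ y x))
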